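{- The weakening rule, which from $\mathcal{R},\Gamma\Rightarrow\Delta$ infers $\mathcal{R},\mathcal{R}',\Gamma,\Gamma'\Rightarrow\Delta,\Delta'$ (for arbitrary multisets $\mathcal{R}'$ of relational atoms and $\Gamma',\Delta'$ of labelled formulas), is height-preserving admissible in $\mathsf{IntQL}$ and in $\mathsf{IntQCL}$: whenever the premise has a derivation of height $h$ in the calculus, the conclusion has a derivation of height at most $h$ in it.
   Context: Language: parameters $\underline{a},\dots$, bound variables $x,\dots$; $\phi::=p(\vec{\underline{a}})\mid\bot\mid\phi\wedge\phi\mid\phi\vee\phi\mid\phi\to\phi\mid\exists x\phi\mid\forall x\phi$. Labelled sequents $\mathcal{R},\Gamma\Rightarrow\Delta$: $\mathcal{R}$ a multiset of relational atoms $w\le u$ (possibly also domain atoms $\underline{a}\in D_w$, unused by the rules), $\Gamma,\Delta$ multisets of labelled formulas. Height of a derivation: maximal number of sequents on a branch. $u$ reachable from $w$: $u=w$ or $\mathcal{R}$ contains $w\le v_1,\dots,v_n\le u$; connected: linked by a chain of atoms in either direction. $\underline{a}$ is $S4$-available ($S5$-available) for $w$ if some $v:\psi\in\Gamma\cup\Delta$ contains $\underline{a}$ with $w$ reachable from $v$ ($v,w$ connected). Eigenvariable: not in the conclusion. Rules of $\mathsf{IntXL}$, $\mathsf{X}\in\{\mathsf{Q},\mathsf{QC}\}$: $(id_*)$: $\mathcal{R},\Gamma,w:p(\vec{\underline{a}})\Rightarrow u:p(\vec{\underline{a}}),\Delta$, $u$ reachable from $w$; $(\bot_l)$: $\mathcal{R},\Gamma,w:\bot\Rightarrow\Delta$;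 $(\wedge_l),(\wedge_r),(\vee_l),(\vee_r)$ standard at one label with shared contexts; $(\to_r)$: $\mathcal{R},w\le u,\Gamma,u:\phi\Rightarrow u:\psi,\Delta$ / $\mathcal{R},\Gamma\Rightarrow w:\phi\to\psi,\Delta$, $u$ eigenvariable; $(Pr_\to)$: $\mathcal{R},w:\phi\to\psi,\Gamma\Rightarrow\Delta,u:\phi$ and $\mathcal{R},w:\phi\to\psi,u:\psi,\Gamma\Rightarrow\Delta$ / $\mathcal{R},w:\phi\to\psi,\Gamma\Rightarrow\Delta$, $u$ reachable from $w$; $(\exists_r)$: $\mathcal{R},\Gamma\Rightarrow\Delta,w:\phi(\underline{a}/x),w:\exists x\phi$ / $\mathcal{R},\Gamma\Rightarrow\Delta,w:\exists x\phi$, $\underline{a}$ $S4$- ($\mathsf{Q}$) resp. $S5$-available ($\mathsf{QC}$) for $w$ or eigenvariable; $(\forall_l)$: $\mathcal{R},w:\forall x\phi,v:\phi(\underline{a}/x),\Gamma\Rightarrow\Delta$ / $\mathcal{R},w:\forall x\phi,\Gamma\Rightarrow\Delta$, $\underline{a}$ $S4$- ($\mathsf{Q}$) resp. $S5$-available ($\mathsf{QC}$) for $v$ or eigenvariable, $v$ reachable from $w$; $(\forall_r)$: $\mathcal{R},w\le u,\Gamma\Rightarrow u:\phi(\underline{a}/x),\Delta$ / $\mathcal{R},\Gamma\Rightarrow w:\forall x\phi,\Delta$, $\underline{a},u$ eigenvariables; $(\exists_l)$: $\mathcal{R},\Gamma,w:\phi(\underline{a}/x)\Rightarrow\Delta$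 / $\mathcal{R},\Gamma,w:\exists x\phi\Rightarrow\Delta$, $\underline{a}$ eigenvariable. $\mathsf{IntQL}$: $\mathsf{X}=\mathsf{Q}$; $\mathsf{IntQCL}$: $\mathsf{X}=\mathsf{QC}$. -}

module Defs where

open import Data.Nat using (ℕ; suc; _⊔_; _≡ᵇ_)
open import Data.Bool using (if_then_else_)
open import Data.List using (List; []; _∷_; _++_; concatMap)
open import Data.List.Membership.Propositional using (_∈_; _∉_)
open import Data.List.Relation.Binary.Permutation.Propositional using (_↭_)
open import Data.Product using (Σ; _×_; ∃)
open import Data.Sum using (_⊎_)

Param : Set
Param = ℕ

Var : Set
Var = ℕ

Label : Set
Label = ℕ

data Term : Set where
  par : Param → Term
  var : Var → Term

data Formula : Set where
  atom : ℕ → List Term → Formula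
  ⊥'   : Formula
  _∧'_ : Formula → Formula → Formula
  _∨'_ : Formula → Formula → Formula
  _⇒'_ : Formula → Formula → Formula
  ex   : Var → Formula → Formula
  all  : Var → Formula → Formula

substT : Param → Var → Term → Term
substT a x (par b) = par b
substT a x (var y) = if x ≡ᵇ y then par a else var y

substTs : Param → Var → List Term → List Term
substTs a x []       = []
substTs a x (t ∷ ts) = substT a x t ∷ substTs a x ts

subst : Param → Var → Formula → Formula
subst a x (atom p ts) = atom p (substTs a x ts)
subst a x ⊥'          = ⊥'
subst a x (φ ∧' ψ)    = subst a x φ ∧' subst a x ψ
subst a x (φ ∨' ψ)    = subst a x φ ∨' subst a x ψ
subst a x (φ ⇒' ψ)    = subst a x φ ⇒' subst a x ψ
subst a x (ex y φ)    = if x ≡ᵇ y then ex y φ else ex y (subst a x φ)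
subst a x (all y φ)   = if x ≡ᵇ y then all y φ else all y (subst a x φ)

paramsT : Term → List Param
paramsT (par a) = a ∷ []
paramsT (var _) = []

params : Formula → List Param
params (atom p ts) = concatMap paramsT ts
params ⊥'          = []
params (φ ∧' ψ)    = params φ ++ params ψ
params (φ ∨' ψ)    = params φ ++ params ψ
params (φ ⇒' ψ)    = params φ ++ params ψ
params (ex _ φ)    = params φ
params (all _ φ)   = params φ

record LFormula : Set where
  constructor _∶_
  field
    lab : Label
    fml : Formula

data RAtom : Set where
  _≤'_  : Label → Label → RAtom
  _∈D_  : Param → Label → RAtom          -- a ∈ D_w (unused by the rules)

infix 3 _⊢_⇒_
infix 7 _∶_

record Sequent : Set where
  constructor _⊢_⇒_
  field
    rel : List RAtom
    ant : List LFormula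
    suc' : List LFormula

labelsR : RAtom → List Label
labelsR (w ≤' u) = w ∷ u ∷ []
labelsR (a ∈D w) = w ∷ []

paramsR : RAtom → List Param
paramsR (w ≤' u) = []
paramsR (a ∈D w) = a ∷ []

labelsL : LFormula → List Label
labelsL (w ∶ φ) = w ∷ []

paramsL : LFormula → List Param
paramsL (w ∶ φ) = params φ

labelsS : Sequent → List Label
labelsS (R ⊢ Γ ⇒ Δ) = concatMap labelsR R ++ concatMap labelsL Γ ++ concatMap labelsL Δ

paramsS : Sequent → List Param
paramsS (R ⊢ Γ ⇒ Δ) = concatMap paramsR R ++ concatMap paramsL Γ ++ concatMap paramsL Δ

data Reach (R : List RAtom) : Label → Label → Set where
  here : ∀ {w} → Reach R w w
  step : ∀ {w v u} → (w ≤' v) ∈ R → Reach R v u → Reach R w u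

data Conn (R : List RAtom) : Label → Label → Set where
  here  : ∀ {w} → Conn R w w
  fwd   : ∀ {w v u} → (w ≤' v) ∈ R → Conn R v u → Conn R w u
  bwd   : ∀ {w v u} → (v ≤' w) ∈ R → Conn R v u → Conn R w u

data Logic : Set where
  Q QC : Logic

-- S4 (for Q) / S5 (for QC) accessibility between the label of a
-- formula v and the target label w
Acc : Logic → List RAtom → Label → Label → Set
Acc Q  R v w = Reach R v w
Acc QC R v w = Conn R v w

Available : Logic → Sequent → Param → Label → Set
Available X (R ⊢ Γ ⇒ Δ) a w =
  Σ Label λ v → Σ Formula λ ψ →
    ((v ∶ ψ) ∈ (Γ ++ Δ)) × (a ∈ params ψ) × Acc X R v w

-- side condition of (∃_r)/(∀_l): available, or an eigenvariable
-- (not occurring in the conclusion s)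
InstOK : Logic → Sequent → Param → Label → Set
InstOK X s a w = Available X s a w ⊎ (a ∉ paramsS s)

-- The calculus IntXL (X = Q: IntQL, X = QC: IntQCL).
-- Multisets are lists; rules decomposing a principal formula match it
-- up to permutation (_↭_), rules keeping it use membership.

data Deriv (X : Logic) : Sequent → Set where
  id* : ∀ {R Γ Δ w u p ts} →
        (w ∶ atom p ts) ∈ Γ → (u ∶ atom p ts) ∈ Δ → Reach R w u →
        Deriv X (R ⊢ Γ ⇒ Δ)
  ⊥l  : ∀ {R Γ Δ w} → (w ∶ ⊥') ∈ Γ → Deriv X (R ⊢ Γ ⇒ Δ)
  ∧l  : ∀ {R Γ Γ₀ Δ w φ ψ} → Γ ↭ ((w ∶ (φ ∧' ψ)) ∷ Γ₀) →
        Deriv X (R ⊢ (w ∶ φ) ∷ (w ∶ ψ) ∷ Γ₀ ⇒ Δ) →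
        Deriv X (R ⊢ Γ ⇒ Δ)
  ∧r  : ∀ {R Γ Δ Δ₀ w φ ψ} → Δ ↭ ((w ∶ (φ ∧' ψ)) ∷ Δ₀) →
        Deriv X (R ⊢ Γ ⇒ (w ∶ φ) ∷ Δ₀) →
        Deriv X (R ⊢ Γ ⇒ (w ∶ ψ) ∷ Δ₀) →
        Deriv X (R ⊢ Γ ⇒ Δ)
  ∨l  : ∀ {R Γ Γ₀ Δ w φ ψ} → Γ ↭ ((w ∶ (φ ∨' ψ)) ∷ Γ₀) →
        Deriv X (R ⊢ (w ∶ φ) ∷ Γ₀ ⇒ Δ) →
        Deriv X (R ⊢ (w ∶ ψ) ∷ Γ₀ ⇒ Δ) →
        Deriv X (R ⊢ Γ ⇒ Δ)
  ∨r  : ∀ {R Γ Δ Δ₀ w φ ψ} → Δ ↭ ((w ∶ (φ ∨' ψ)) ∷ Δ₀) →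
        Deriv X (R ⊢ Γ ⇒ (w ∶ φ) ∷ (w ∶ ψ) ∷ Δ₀) →
        Deriv X (R ⊢ Γ ⇒ Δ)
  →r  : ∀ {R Γ Δ Δ₀ w u φ ψ} → Δ ↭ ((w ∶ (φ ⇒' ψ)) ∷ Δ₀) →
        u ∉ labelsS (R ⊢ Γ ⇒ Δ) →
        Deriv X (((w ≤' u) ∷ R) ⊢ (u ∶ φ) ∷ Γ ⇒ (u ∶ ψ) ∷ Δ₀) →
        Deriv X (R ⊢ Γ ⇒ Δ)
  Pr→ : ∀ {R Γ Δ w u φ ψ} → (w ∶ (φ ⇒' ψ)) ∈ Γ → Reach R w u →
        Deriv X (R ⊢ Γ ⇒ (u ∶ φ) ∷ Δ) →
        Deriv X (R ⊢ (u ∶ ψ) ∷ Γ ⇒ Δ) →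
        Deriv X (R ⊢ Γ ⇒ Δ)
  ∃r  : ∀ {R Γ Δ w x a φ} → (w ∶ ex x φ) ∈ Δ →
        InstOK X (R ⊢ Γ ⇒ Δ) a w →
        Deriv X (R ⊢ Γ ⇒ (w ∶ subst a x φ) ∷ Δ) →
        Deriv X (R ⊢ Γ ⇒ Δ)
  ∀l  : ∀ {R Γ Δ w v x a φ} → (w ∶ all x φ) ∈ Γ → Reach R w v →
        InstOK X (R ⊢ Γ ⇒ Δ) a v →
        Deriv X (R ⊢ (v ∶ subst a x φ) ∷ Γ ⇒ Δ) →
        Deriv X (R ⊢ Γ ⇒ Δ)
  ∀r  : ∀ {R Γ Δ Δ₀ w u x a φ} → Δ ↭ ((w ∶ all x φ) ∷ Δ₀) →
        u ∉ labelsS (R ⊢ Γ ⇒ Δ) → a ∉ paramsS (R ⊢ Γ ⇒ Δ) →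
        Deriv X (((w ≤' u) ∷ R) ⊢ Γ ⇒ (u ∶ subst a x φ) ∷ Δ₀) →
        Deriv X (R ⊢ Γ ⇒ Δ)
  ∃l  : ∀ {R Γ Γ₀ Δ w x a φ} → Γ ↭ ((w ∶ ex x φ) ∷ Γ₀) →
        a ∉ paramsS (R ⊢ Γ ⇒ Δ) →
        Deriv X (R ⊢ (w ∶ subst a x φ) ∷ Γ₀ ⇒ Δ) →
        Deriv X (R ⊢ Γ ⇒ Δ)

height : ∀ {X s} → Deriv X s → ℕ
height (id* _ _ _)       = 1
height (⊥l _)            = 1
height (∧l _ d)          = suc (height d)
height (∧r _ d e)        = suc (height d ⊔ height e)
height (∨l _ d e)        = suc (height d ⊔ height e)
height (∨r _ d)          = suc (height d)
height (→r _ _ d)        = suc (height d)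
height (Pr→ _ _ d e)     = suc (height d ⊔ height e)
height (∃r _ _ d)        = suc (height d)
height (∀l _ _ _ d)      = suc (height d)
height (∀r _ _ _ d)      = suc (height d)
height (∃l _ _ d)        = suc (height d)

-- Weakening is proved simultaneously with closure under arbitrary (not
-- necessarily injective) renamings ρ of labels and π of parameters.  The
-- renaming is what makes the eigenvariable rules go through: an eigenvariable
-- of the given derivation may clash with the weakening material, so it is
-- renamed to a name fresh for the weakened conclusion, and this renaming must
-- be pushed through the subderivation without increasing its height.
module Submission where

open import Defs
open import Data.Nat using (ℕ; suc; _≤_; _≟_; _≡ᵇ_; s≤s)
open import Data.Nat.Properties using (≤-refl; ⊔-mono-≤; m≤m+n; m≤n+m; ≤-trans; 1+n≰n)
open import Data.Nat.ListAction using (sum)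
open import Data.Bool using (true; false)
open import Data.List using (List; []; _∷_; _++_; map; concatMap)
open import Data.List.Properties using (map-++; map-id; map-cong; map-cong-local)
open import Data.List.Relation.Unary.Any using (here; there)
import Data.List.Relation.Unary.All as All
open import Data.List.Membership.Propositional using (_∈_; _∉_; lose)
open import Data.List.Membership.Propositional.Properties
  using (∈-map⁺; ∈-++⁺ˡ; ∈-++⁺ʳ; ∈-concatMap⁺)
open import Data.List.Relation.Binary.Subset.Propositional using (_⊆_)
open import Data.List.Relation.Binary.Subset.Propositional.Properties using (xs⊆xs++ys; ++⁺)
open import Data.List.Relation.Binary.Permutation.Propositional using (_↭_)
open import Data.List.Relation.Binary.Permutation.Propositional.Properties using (map⁺; ++⁺ʳ)
open import Data.Product using (Σ; _,_)
open import Data.Sum using (inj₁; inj₂)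
open import Data.Empty using (⊥-elim)
open import Function using (id; _∘_)
open import Relation.Nullary using (yes; no)
open import Relation.Binary.PropositionalEquality
  using (_≡_; refl; sym; trans; cong; cong₂; subst₂)
import Relation.Binary.PropositionalEquality as ≡

renT : (Param → Param) → Term → Term
renT π (par a) = par (π a)
renT π (var x) = var x

renF : (Param → Param) → Formula → Formula
renF π (atom p ts) = atom p (map (renT π) ts)
renF π ⊥'          = ⊥'
renF π (φ ∧' ψ)    = renF π φ ∧' renF π ψ
renF π (φ ∨' ψ)    = renF π φ ∨' renF π ψ
renF π (φ ⇒' ψ)    = renF π φ ⇒' renF π ψ
renF π (ex x φ)    = ex x (renF π φ)
renF π (all x φ)   = all x (renF π φ)

renL : (Label → Label) → (Param → Param) → LFormula → LFormula
renL ρ π (w ∶ φ) = ρ w ∶ renF π φ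

renR : (Label → Label) → (Param → Param) → RAtom → RAtom
renR ρ π (w ≤' u) = ρ w ≤' ρ u
renR ρ π (a ∈D w) = π a ∈D ρ w

renS : (Label → Label) → (Param → Param) → Sequent → Sequent
renS ρ π (R ⊢ Γ ⇒ Δ) = map (renR ρ π) R ⊢ map (renL ρ π) Γ ⇒ map (renL ρ π) Δ

infixl 5 _++ₛ_

_++ₛ_ : Sequent → Sequent → Sequent
(R ⊢ Γ ⇒ Δ) ++ₛ (R' ⊢ Γ' ⇒ Δ') = (R ++ R') ⊢ (Γ ++ Γ') ⇒ (Δ ++ Δ')

⊢⇒-cong : ∀ {R R' Γ Γ' Δ Δ'} → R ≡ R' → Γ ≡ Γ' → Δ ≡ Δ' →
  (R ⊢ Γ ⇒ Δ) ≡ (R' ⊢ Γ' ⇒ Δ')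
⊢⇒-cong refl refl refl = refl

fresh : List ℕ → ℕ
fresh xs = suc (sum xs)

fresh-∉ : ∀ xs → fresh xs ∉ xs
fresh-∉ xs m = 1+n≰n (∈⇒≤sum xs m)
  where
  ∈⇒≤sum : ∀ {x} xs → x ∈ xs → x ≤ sum xs
  ∈⇒≤sum (y ∷ ys) (here refl) = m≤m+n y (sum ys)
  ∈⇒≤sum (y ∷ ys) (there p)   = ≤-trans (∈⇒≤sum ys p) (m≤n+m (sum ys) y)

upd : (ℕ → ℕ) → ℕ → ℕ → ℕ → ℕ
upd f u u' x with x ≟ u
... | yes _ = u'
... | no  _ = f x

upd-≡ : ∀ f u u' → upd f u u' u ≡ u'
upd-≡ f u u' with u ≟ u
... | yes _  = refl
... | no u≢u = ⊥-elim (u≢u refl)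

Agree : (ℕ → ℕ) → (ℕ → ℕ) → List ℕ → Set
Agree f g xs = ∀ {x} → x ∈ xs → f x ≡ g x

upd-agree : ∀ {f u u' xs} → u ∉ xs → Agree (upd f u u') f xs
upd-agree {f} {u} {u'} u∉ {x} x∈ with x ≟ u
... | yes refl = ⊥-elim (u∉ x∈)
... | no  _    = refl

Agree-concatMap : ∀ {A : Set} {f g : ℕ → ℕ} (h : A → List ℕ) {L y} →
  Agree f g (concatMap h L) → y ∈ L → Agree f g (h y)
Agree-concatMap h agr y∈ x∈ = agr (∈-concatMap⁺ h (lose y∈ x∈))

map-cong-∈ : ∀ {A B : Set} {f g : A → B} {L} →
  (∀ {y} → y ∈ L → f y ≡ g y) → map f L ≡ map g L
map-cong-∈ = map-cong-local ∘ All.tabulate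

renF-id : ∀ φ → renF id φ ≡ φ
renF-id (atom p ts) = cong (atom p) (trans (map-cong renT-id ts) (map-id ts))
  where
  renT-id : ∀ t → renT id t ≡ t
  renT-id (par a) = refl
  renT-id (var x) = refl
renF-id ⊥'          = refl
renF-id (φ ∧' ψ)    = cong₂ _∧'_ (renF-id φ) (renF-id ψ)
renF-id (φ ∨' ψ)    = cong₂ _∨'_ (renF-id φ) (renF-id ψ)
renF-id (φ ⇒' ψ)    = cong₂ _⇒'_ (renF-id φ) (renF-id ψ)
renF-id (ex x φ)    = cong (ex x) (renF-id φ)
renF-id (all x φ)   = cong (all x) (renF-id φ)

renS-id : ∀ s → renS id id s ≡ s
renS-id (R ⊢ Γ ⇒ Δ) = ⊢⇒-cong (map-id-by renR-id R) (map-id-by renL-id Γ) (map-id-by renL-id Δ)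
  where
  map-id-by : ∀ {A : Set} {f : A → A} → (∀ y → f y ≡ y) → ∀ L → map f L ≡ L
  map-id-by f≗id L = trans (map-cong f≗id L) (map-id L)
  renR-id : ∀ r → renR id id r ≡ r
  renR-id (w ≤' u) = refl
  renR-id (a ∈D w) = refl
  renL-id : ∀ A → renL id id A ≡ A
  renL-id (w ∶ φ) = cong (w ∶_) (renF-id φ)

renF-cong : ∀ {π π'} φ → Agree π π' (params φ) → renF π φ ≡ renF π' φ
renF-cong (atom p ts) agr = cong (atom p) (map-cong-∈ renT-cong)
  where
  renT-cong : ∀ {t} → t ∈ ts → renT _ t ≡ renT _ t
  renT-cong {par a} t∈ = cong par (Agree-concatMap paramsT agr t∈ (here refl))
  renT-cong {var x} t∈ = refl
renF-cong ⊥'        agr = refl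
renF-cong (φ ∧' ψ)  agr =
  cong₂ _∧'_ (renF-cong φ (agr ∘ ∈-++⁺ˡ)) (renF-cong ψ (agr ∘ ∈-++⁺ʳ _))
renF-cong (φ ∨' ψ)  agr =
  cong₂ _∨'_ (renF-cong φ (agr ∘ ∈-++⁺ˡ)) (renF-cong ψ (agr ∘ ∈-++⁺ʳ _))
renF-cong (φ ⇒' ψ)  agr =
  cong₂ _⇒'_ (renF-cong φ (agr ∘ ∈-++⁺ˡ)) (renF-cong ψ (agr ∘ ∈-++⁺ʳ _))
renF-cong (ex x φ)  agr = cong (ex x) (renF-cong φ agr)
renF-cong (all x φ) agr = cong (all x) (renF-cong φ agr)

renS-cong : ∀ {ρ ρ' π π'} s → Agree ρ ρ' (labelsS s) → Agree π π' (paramsS s) →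
  renS ρ π s ≡ renS ρ' π' s
renS-cong (R ⊢ Γ ⇒ Δ) agrˡ agrᵖ = ⊢⇒-cong
  (map-cong-∈ λ r∈ → renR-cong _ (Agree-concatMap labelsR (agrˡ ∘ ∈-++⁺ˡ) r∈)
                                 (Agree-concatMap paramsR (agrᵖ ∘ ∈-++⁺ˡ) r∈))
  (map-cong-∈ λ A∈ → renL-cong _ (Agree-concatMap labelsL (agrˡ ∘ ∈-++⁺ʳ ℓR ∘ ∈-++⁺ˡ) A∈)
                                 (Agree-concatMap paramsL (agrᵖ ∘ ∈-++⁺ʳ pR ∘ ∈-++⁺ˡ) A∈))
  (map-cong-∈ λ A∈ → renL-cong _ (Agree-concatMap labelsL (agrˡ ∘ ∈-++⁺ʳ ℓR ∘ ∈-++⁺ʳ ℓΓ) A∈)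
                                 (Agree-concatMap paramsL (agrᵖ ∘ ∈-++⁺ʳ pR ∘ ∈-++⁺ʳ pΓ) A∈))
  where
  ℓR ℓΓ : List Label
  pR pΓ : List Param
  ℓR = concatMap labelsR R
  ℓΓ = concatMap labelsL Γ
  pR = concatMap paramsR R
  pΓ = concatMap paramsL Γ
  renR-cong : ∀ {ρ ρ' π π'} r → Agree ρ ρ' (labelsR r) → Agree π π' (paramsR r) →
    renR ρ π r ≡ renR ρ' π' r
  renR-cong (w ≤' u) agrˡ agrᵖ = cong₂ _≤'_ (agrˡ (here refl)) (agrˡ (there (here refl)))
  renR-cong (a ∈D w) agrˡ agrᵖ = cong₂ _∈D_ (agrᵖ (here refl)) (agrˡ (here refl))
  renL-cong : ∀ {ρ ρ' π π'} A → Agree ρ ρ' (labelsL A) → Agree π π' (paramsL A) →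
    renL ρ π A ≡ renL ρ' π' A
  renL-cong (w ∶ φ) agrˡ agrᵖ = cong₂ _∶_ (agrˡ (here refl)) (renF-cong φ agrᵖ)

renF-subst : ∀ π a x φ → renF π (subst a x φ) ≡ subst (π a) x (renF π φ)
renF-subst π a x (atom p ts) = cong (atom p) (renTs-substTs ts)
  where
  renTs-substTs : ∀ ts → map (renT π) (substTs a x ts) ≡ substTs (π a) x (map (renT π) ts)
  renTs-substTs []           = refl
  renTs-substTs (par b ∷ ts) = cong (par (π b) ∷_) (renTs-substTs ts)
  renTs-substTs (var y ∷ ts) with x ≡ᵇ y
  ... | true  = cong (par (π a) ∷_) (renTs-substTs ts)
  ... | false = cong (var y ∷_) (renTs-substTs ts)
renF-subst π a x ⊥'       = refl
renF-subst π a x (φ ∧' ψ) = cong₂ _∧'_ (renF-subst π a x φ) (renF-subst π a x ψ)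
renF-subst π a x (φ ∨' ψ) = cong₂ _∨'_ (renF-subst π a x φ) (renF-subst π a x ψ)
renF-subst π a x (φ ⇒' ψ) = cong₂ _⇒'_ (renF-subst π a x φ) (renF-subst π a x ψ)
renF-subst π a x (ex y φ) with x ≡ᵇ y
... | true  = refl
... | false = cong (ex y) (renF-subst π a x φ)
renF-subst π a x (all y φ) with x ≡ᵇ y
... | true  = refl
... | false = cong (all y) (renF-subst π a x φ)

params-renF : ∀ π φ → params (renF π φ) ≡ map π (params φ)
params-renF π (atom p ts) = paramsTs-renTs ts
  where
  paramsTs-renTs : ∀ ts → concatMap paramsT (map (renT π) ts) ≡ map π (concatMap paramsT ts)
  paramsTs-renTs []           = refl
  paramsTs-renTs (par a ∷ ts) = cong (π a ∷_) (paramsTs-renTs ts)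
  paramsTs-renTs (var x ∷ ts) = paramsTs-renTs ts
params-renF π ⊥'        = refl
params-renF π (φ ∧' ψ)  =
  trans (cong₂ _++_ (params-renF π φ) (params-renF π ψ)) (sym (map-++ π (params φ) (params ψ)))
params-renF π (φ ∨' ψ)  =
  trans (cong₂ _++_ (params-renF π φ) (params-renF π ψ)) (sym (map-++ π (params φ) (params ψ)))
params-renF π (φ ⇒' ψ)  =
  trans (cong₂ _++_ (params-renF π φ) (params-renF π ψ)) (sym (map-++ π (params φ) (params ψ)))
params-renF π (ex x φ)  = params-renF π φ
params-renF π (all x φ) = params-renF π φ

EdgeMap : (Label → Label) → List RAtom → List RAtom → Set
EdgeMap f R R' = ∀ {w v} → (w ≤' v) ∈ R → (f w ≤' f v) ∈ R'

Reach-map : ∀ {f R R' w u} → EdgeMap f R R' → Reach R w u → Reach R' (f w) (f u)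
Reach-map edge here       = here
Reach-map edge (step e r) = step (edge e) (Reach-map edge r)

Conn-map : ∀ {f R R' w u} → EdgeMap f R R' → Conn R w u → Conn R' (f w) (f u)
Conn-map edge here      = here
Conn-map edge (fwd e c) = fwd (edge e) (Conn-map edge c)
Conn-map edge (bwd e c) = bwd (edge e) (Conn-map edge c)

Acc-map : ∀ X {f R R' w u} → EdgeMap f R R' → Acc X R w u → Acc X R' (f w) (f u)
Acc-map Q  = Reach-map
Acc-map QC = Conn-map

∈-map-++⁺ : ∀ {A : Set} (f : A → A) {y L} L' → y ∈ L → f y ∈ map f L ++ L'
∈-map-++⁺ f L' = ∈-++⁺ˡ ∘ ∈-map⁺ f

↭-map-++ : ∀ {A : Set} (f : A → A) {L L₀ y} L' →
  L ↭ y ∷ L₀ → map f L ++ L' ↭ f y ∷ (map f L₀ ++ L')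
↭-map-++ f L' = ++⁺ʳ L' ∘ map⁺ f

Deriv≤ : Logic → Sequent → ℕ → Set
Deriv≤ X s h = Σ (Deriv X s) (λ d → height d ≤ h)

cast≤ : ∀ {X s s' h} → s ≡ s' → Deriv≤ X s h → Deriv≤ X s' h
cast≤ refl d = d

cast≤-⇒∷ : ∀ {X R Γ Δ w φ ψ h} → φ ≡ ψ →
  Deriv≤ X (R ⊢ Γ ⇒ (w ∶ φ) ∷ Δ) h → Deriv≤ X (R ⊢ Γ ⇒ (w ∶ ψ) ∷ Δ) h
cast≤-⇒∷ refl d = d

cast≤-∷⇒ : ∀ {X R Γ Δ w φ ψ h} → φ ≡ ψ →
  Deriv≤ X (R ⊢ (w ∶ φ) ∷ Γ ⇒ Δ) h → Deriv≤ X (R ⊢ (w ∶ ψ) ∷ Γ ⇒ Δ) h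
cast≤-∷⇒ refl d = d

module _ (R' : List RAtom) (Γ' Δ' : List LFormula) where

  private
    W : Sequent
    W = R' ⊢ Γ' ⇒ Δ'

  fresh-after-renaming : ∀ (names : Sequent → List ℕ) {s ρ π ρ' π' x} →
    renS ρ' π' s ≡ renS ρ π s → x ≡ fresh (names (renS ρ π s ++ₛ W)) →
    x ∉ names (renS ρ' π' s ++ₛ W)
  fresh-after-renaming names ren≡ x≡ =
    subst₂ (λ y t → y ∉ names (t ++ₛ W)) (sym x≡) (sym ren≡) (fresh-∉ _)

  relabel : (Label → Label) → (Param → Param) → Sequent → Label → Label → Label
  relabel ρ π s u = upd ρ u (fresh (labelsS (renS ρ π s ++ₛ W)))

  reparam : (Label → Label) → (Param → Param) → Sequent → Param → Param → Param
  reparam ρ π s a = upd π a (fresh (paramsS (renS ρ π s ++ₛ W)))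

  relabel-invisible : ∀ ρ π s {u} → u ∉ labelsS s → renS (relabel ρ π s u) π s ≡ renS ρ π s
  relabel-invisible ρ π s u∉ = renS-cong s (upd-agree u∉) (λ _ → refl)

  reparam-invisible : ∀ ρ π s {a} → a ∉ paramsS s → renS ρ (reparam ρ π s a) s ≡ renS ρ π s
  reparam-invisible ρ π s a∉ = renS-cong s (λ _ → refl) (upd-agree a∉)

  relabel-fresh : ∀ ρ π s {u} → u ∉ labelsS s →
    relabel ρ π s u u ∉ labelsS (renS (relabel ρ π s u) π s ++ₛ W)
  relabel-fresh ρ π s {u} u∉ =
    fresh-after-renaming labelsS (relabel-invisible ρ π s u∉) (upd-≡ ρ u _)

  reparam-fresh : ∀ ρ π s {a} → a ∉ paramsS s →
    reparam ρ π s a a ∉ paramsS (renS ρ (reparam ρ π s a) s ++ₛ W)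
  reparam-fresh ρ π s {a} a∉ =
    fresh-after-renaming paramsS (reparam-invisible ρ π s a∉) (upd-≡ π a _)

  renR-edge : ∀ {ρ π} R → EdgeMap ρ R (map (renR ρ π) R ++ R')
  renR-edge {ρ} {π} R = ∈-map-++⁺ (renR ρ π) R'

  Available-rename-weaken : ∀ {X ρ π s a w} →
    Available X s a w → Available X (renS ρ π s ++ₛ W) (π a) (ρ w)
  Available-rename-weaken {X} {ρ} {π} {R ⊢ Γ ⇒ Δ} (v , χ , v∈ , a∈ , acc) =
    ρ v , renF π χ , ∈-weaken (≡.subst (_ ∈_) (map-++ (renL ρ π) Γ Δ) (∈-map⁺ (renL ρ π) v∈))
        , ≡.subst (π _ ∈_) (sym (params-renF π χ)) (∈-map⁺ π a∈)
        , Acc-map X (renR-edge R) acc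
    where
    ∈-weaken : map (renL ρ π) Γ ++ map (renL ρ π) Δ ⊆
               (map (renL ρ π) Γ ++ Γ') ++ (map (renL ρ π) Δ ++ Δ')
    ∈-weaken = ++⁺ (xs⊆xs++ys (map (renL ρ π) Γ) Γ') (xs⊆xs++ys (map (renL ρ π) Δ) Δ')

  rename-weaken : ∀ {X s} (ρ : Label → Label) (π : Param → Param) (d : Deriv X s) →
    Deriv≤ X (renS ρ π s ++ₛ W) (height d)
  rename-weaken ρ π (id* w∈ u∈ r) =
    id* (∈-map-++⁺ (renL ρ π) Γ' w∈) (∈-map-++⁺ (renL ρ π) Δ' u∈) (Reach-map (renR-edge _) r)
    , ≤-refl
  rename-weaken ρ π (⊥l w∈) = ⊥l (∈-map-++⁺ (renL ρ π) Γ' w∈) , ≤-refl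
  rename-weaken ρ π (∧l Γ↭ d) =
    let d' , h = rename-weaken ρ π d
    in ∧l (↭-map-++ (renL ρ π) Γ' Γ↭) d' , s≤s h
  rename-weaken ρ π (∧r Δ↭ d e) =
    let d' , h = rename-weaken ρ π d ; e' , h' = rename-weaken ρ π e
    in ∧r (↭-map-++ (renL ρ π) Δ' Δ↭) d' e' , s≤s (⊔-mono-≤ h h')
  rename-weaken ρ π (∨l Γ↭ d e) =
    let d' , h = rename-weaken ρ π d ; e' , h' = rename-weaken ρ π e
    in ∨l (↭-map-++ (renL ρ π) Γ' Γ↭) d' e' , s≤s (⊔-mono-≤ h h')
  rename-weaken ρ π (∨r Δ↭ d) =
    let d' , h = rename-weaken ρ π d
    in ∨r (↭-map-++ (renL ρ π) Δ' Δ↭) d' , s≤s h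
  rename-weaken ρ π (Pr→ w∈ r d e) =
    let d' , h = rename-weaken ρ π d ; e' , h' = rename-weaken ρ π e
    in Pr→ (∈-map-++⁺ (renL ρ π) Γ' w∈) (Reach-map (renR-edge _) r) d' e' , s≤s (⊔-mono-≤ h h')
  rename-weaken {s = s} ρ π (→r {u = u} Δ↭ u∉ d) =
    let d' , h = rename-weaken ρ' π d
    in cast≤ (cong (_++ₛ W) (relabel-invisible ρ π s u∉))
         (→r (↭-map-++ (renL ρ' π) Δ' Δ↭) (relabel-fresh ρ π s u∉) d' , s≤s h)
    where
    ρ' : Label → Label
    ρ' = relabel ρ π s u
  rename-weaken {s = s} ρ π (∃r {x = x} {a} {φ} w∈ (inj₁ avail) d) =
    let d' , h = cast≤-⇒∷ (renF-subst π a x φ) (rename-weaken ρ π d)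
    in ∃r (∈-map-++⁺ (renL ρ π) Δ' w∈) (inj₁ (Available-rename-weaken {ρ = ρ} {s = s} avail)) d'
       , s≤s h
  rename-weaken {s = s} ρ π (∃r {x = x} {a} {φ} w∈ (inj₂ a∉) d) =
    let d' , h = cast≤-⇒∷ (renF-subst π' a x φ) (rename-weaken ρ π' d)
    in cast≤ (cong (_++ₛ W) (reparam-invisible ρ π s a∉))
         (∃r (∈-map-++⁺ (renL ρ π') Δ' w∈) (inj₂ (reparam-fresh ρ π s a∉)) d' , s≤s h)
    where
    π' : Param → Param
    π' = reparam ρ π s a
  rename-weaken {s = s} ρ π (∀l {x = x} {a} {φ} w∈ r (inj₁ avail) d) =
    let d' , h = cast≤-∷⇒ (renF-subst π a x φ) (rename-weaken ρ π d)
    in ∀l (∈-map-++⁺ (renL ρ π) Γ' w∈) (Reach-map (renR-edge _) r)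
          (inj₁ (Available-rename-weaken {ρ = ρ} {s = s} avail)) d' , s≤s h
  rename-weaken {s = s} ρ π (∀l {x = x} {a} {φ} w∈ r (inj₂ a∉) d) =
    let d' , h = cast≤-∷⇒ (renF-subst π' a x φ) (rename-weaken ρ π' d)
    in cast≤ (cong (_++ₛ W) (reparam-invisible ρ π s a∉))
         (∀l (∈-map-++⁺ (renL ρ π') Γ' w∈) (Reach-map (renR-edge _) r)
             (inj₂ (reparam-fresh ρ π s a∉)) d' , s≤s h)
    where
    π' : Param → Param
    π' = reparam ρ π s a
  rename-weaken {s = s} ρ π (∀r {u = u} {x} {a} {φ} Δ↭ u∉ a∉ d) =
    let d' , h = cast≤-⇒∷ (renF-subst π' a x φ) (rename-weaken ρ' π' d)
    in cast≤ (cong (_++ₛ W) ρ'π'≈ρπ)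
         (∀r (↭-map-++ (renL ρ' π') Δ' Δ↭) u'∉ a'∉ d' , s≤s h)
    where
    ρ' : Label → Label
    ρ' = relabel ρ π s u
    π' : Param → Param
    π' = reparam ρ π s a
    ρ'π'≈ρπ : renS ρ' π' s ≡ renS ρ π s
    ρ'π'≈ρπ = renS-cong s (upd-agree u∉) (upd-agree a∉)
    u'∉ : ρ' u ∉ labelsS (renS ρ' π' s ++ₛ W)
    u'∉ = fresh-after-renaming labelsS ρ'π'≈ρπ (upd-≡ ρ u _)
    a'∉ : π' a ∉ paramsS (renS ρ' π' s ++ₛ W)
    a'∉ = fresh-after-renaming paramsS ρ'π'≈ρπ (upd-≡ π a _)
  rename-weaken {s = s} ρ π (∃l {x = x} {a} {φ} Γ↭ a∉ d) =
    let d' , h = cast≤-∷⇒ (renF-subst π' a x φ) (rename-weaken ρ π' d)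
    in cast≤ (cong (_++ₛ W) (reparam-invisible ρ π s a∉))
         (∃l (↭-map-++ (renL ρ π') Γ' Γ↭) (reparam-fresh ρ π s a∉) d' , s≤s h)
    where
    π' : Param → Param
    π' = reparam ρ π s a

mainTheorem13 : (X : Logic) (R R' : List RAtom) (Γ Γ' Δ Δ' : List LFormula)
    → (d : Deriv X (R ⊢ Γ ⇒ Δ))
    → Σ (Deriv X ((R ++ R') ⊢ (Γ ++ Γ') ⇒ (Δ ++ Δ'))) (λ d' → height d' ≤ height d)
mainTheorem13 X R R' Γ Γ' Δ Δ' d =
  cast≤ (cong (_++ₛ (R' ⊢ Γ' ⇒ Δ')) (renS-id (R ⊢ Γ ⇒ Δ))) (rename-weaken R' Γ' Δ' id id d)
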